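{- Let $G$ be a connected graph of order $n\geq 2$. Then $D'(G\star K_m)=2$ for every $m\geq 2$, except that $D'(K_2\star K_2)=3$.
   Context: $K_m$ is the complete graph on $m$ vertices. The co-normal product $G\star H$ has vertex set $V(G)\times V(H)$ and edge set $\{\{(x_1,x_2),(y_1,y_2)\} : x_1y_1\in E(G) \text{ or } x_2y_2\in E(H)\}$. The distinguishing index $D'(G)$ is the least integer $d$ such that $G$ has an edge labeling with $d$ labels preserved only by the trivial automorphism. -}

module Defs where

open import Data.Bool using (Bool; true; false; _∨_; not)
open import Data.Bool.Properties using (∨-comm)
open import Data.Nat using (ℕ; _≤_)
open import Data.Fin using (Fin)
open import Data.Fin.Properties using (_≟_)
open import Data.Product using (Σ; _×_; _,_; proj₁; proj₂)
open import Function.Bundles using (_↔_; Inverse)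
open import Relation.Nullary using (does)
open import Relation.Nullary.Decidable using (⌊_⌋)
open import Relation.Binary.PropositionalEquality using (_≡_; refl; cong₂; sym)

record Graph (V : Set) : Set where
  field
    adj    : V → V → Bool
    adj-sym : ∀ x y → adj x y ≡ adj y x
    adj-irr : ∀ x → adj x x ≡ false
open Graph public

data Reach {V : Set} (G : Graph V) : V → V → Set where
  here : ∀ {x} → Reach G x x
  step : ∀ {x y z} → adj G x y ≡ true → Reach G y z → Reach G x z

Connected : {V : Set} → Graph V → Set
Connected G = ∀ x y → Reach G x y

private
  ≟-sym : ∀ {m} (x y : Fin m) → not (does (x ≟ y)) ≡ not (does (y ≟ x))
  ≟-sym x y with x ≟ y | y ≟ x
  ... | Relation.Nullary.yes _ | Relation.Nullary.yes _ = refl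
  ... | Relation.Nullary.no _  | Relation.Nullary.no _  = refl
  ... | Relation.Nullary.yes p | Relation.Nullary.no q with q (sym p)
  ... | ()
  ≟-sym x y | Relation.Nullary.no q | Relation.Nullary.yes p with q (sym p)
  ... | ()

  ≟-irr : ∀ {m} (x : Fin m) → not (does (x ≟ x)) ≡ false
  ≟-irr x with x ≟ x
  ... | Relation.Nullary.yes _ = refl
  ... | Relation.Nullary.no q with q refl
  ... | ()

K : (m : ℕ) → Graph (Fin m)
K m = record
  { adj = λ x y → not (does (x ≟ y))
  ; adj-sym = ≟-sym
  ; adj-irr = ≟-irr
  }

private
  ∨-irr : ∀ {a b : Bool} → a ≡ false → b ≡ false → (a ∨ b) ≡ false
  ∨-irr refl refl = refl

_⋆_ : {V W : Set} → Graph V → Graph W → Graph (V × W)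
G ⋆ H = record
  { adj = λ p q → adj G (proj₁ p) (proj₁ q) ∨ adj H (proj₂ p) (proj₂ q)
  ; adj-sym = λ p q → cong₂ _∨_ (adj-sym G (proj₁ p) (proj₁ q)) (adj-sym H (proj₂ p) (proj₂ q))
  ; adj-irr = λ p → ∨-irr (adj-irr G (proj₁ p)) (adj-irr H (proj₂ p))
  }

record Automorphism {V : Set} (G : Graph V) : Set where
  field
    perm     : V ↔ V
    preserves : ∀ x y → adj G (Inverse.to perm x) (Inverse.to perm y) ≡ adj G x y
open Automorphism public

-- An edge labeling with d labels: a label for each unordered pair
-- (represented symmetrically); only values on edges matter.
record EdgeLabeling {V : Set} (G : Graph V) (d : ℕ) : Set where
  field
    label     : V → V → Fin d
    label-sym : ∀ x y → label x y ≡ label y x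
open EdgeLabeling public

PreservesLabeling : {V : Set} {G : Graph V} {d : ℕ} →
                    Automorphism G → EdgeLabeling G d → Set
PreservesLabeling {G = G} σ c =
  ∀ x y → adj G x y ≡ true →
    label c (Inverse.to (perm σ) x) (Inverse.to (perm σ) y) ≡ label c x y

Distinguishing : {V : Set} {G : Graph V} {d : ℕ} → EdgeLabeling G d → Set
Distinguishing {G = G} c =
  (σ : Automorphism G) → PreservesLabeling σ c → ∀ x → Inverse.to (perm σ) x ≡ x

HasDistinguishingLabeling : {V : Set} → Graph V → ℕ → Set
HasDistinguishingLabeling G d = Σ (EdgeLabeling G d) Distinguishing

DistIndex : {V : Set} → Graph V → ℕ → Set
DistIndex G d = HasDistinguishingLabeling G d × (∀ k → HasDistinguishingLabeling G k → d ≤ k)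

-- Number the vertices of G ⋆ K m as 0, …, nm − 1 so that the K m-layer of a vertex
-- is its index mod m, and label 1 the edges of the spider made of the path 1 — 2 — ⋯ — (nm − 1)
-- and the pendant edge 0 — c, where c ∈ {3, 4} is chosen with m ∤ c. Indices differing by 1 or
-- by c lie in different layers, so these are edges of G ⋆ K m. An automorphism preserving the
-- labeling is an automorphism of the spider, and the spider is asymmetric once nm > 2c because
-- its three legs at the hub c have lengths 1, c − 1 and nm − 1 − c. The products K₂ ⋆ K₃,
-- G ⋆ K₂ with three vertices in G, and K₂ ⋆ K₂ with three labels are settled by exhaustive
-- search, as is the fact that K₂ ⋆ K₂ = K₄ has no distinguishing 2-labeling. One label never
-- suffices, since swapping two layers of K m is a nontrivial automorphism.
module Submission where

open import Defs
open import Data.Bool using (Bool; true; false; _∨_; _∧_; not; T; if_then_else_)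
open import Data.Bool.ListAction using (all; any)
open import Data.Bool.Properties using (∨-zeroʳ; ∨-comm; T-∧; T-≡) renaming (_≟_ to _≟ᵇ_)
open import Data.Empty using (⊥; ⊥-elim)
open import Data.Fin using (Fin; toℕ; fromℕ<; combine)
open import Data.Fin.Patterns using (0F; 1F; 2F)
open import Data.Fin.Permutation using (Permutation′; transpose; _⟨$⟩ʳ_)
open import Data.Fin.Properties using (toℕ-injective; toℕ-fromℕ<; toℕ≤pred[n]; toℕ-combine; *↔×; all?)
  renaming (_≟_ to _≟ᶠ_)
open import Data.List using (List; []; _∷_; allFin; cartesianProduct; map)
open import Data.List.Membership.Propositional using (_∈_)
open import Data.List.Membership.Propositional.Properties using (∈-allFin; ∈-cartesianProduct⁺)
import Data.List.Relation.Unary.All as All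
open All using (All; []; _∷_)
open import Data.List.Relation.Unary.All.Properties using (all⁺; all⁻)
open import Data.List.Relation.Unary.Any using (satisfied)
open import Data.List.Relation.Unary.Any.Properties using (any⁻)
open import Data.Nat using (ℕ; zero; suc; _+_; _*_; _∸_; _⊓_; _≤_; _<_; z≤n; s≤s; _≡ᵇ_)
open import Data.Nat.Divisibility using (_∣_; _∣?_; ∣m+n∣m⇒∣n; m∣m*n; ∣-trans; 1∣_; >⇒∤)
open import Data.Nat.Properties
open import Data.Product using (∃; ∃₂; _×_; _,_; proj₁; proj₂)
open import Data.Product.Function.NonDependent.Propositional using (_×-↔_)
open import Data.Product.Properties using (≡-dec)
open import Data.Sum using (_⊎_; inj₁; inj₂)
import Data.Sum as Sum
open import Function using (_∘′_)
open import Function.Bundles using (_↔_; Inverse; Injection; Equivalence; mk↔ₛ′)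
open import Function.Properties.Inverse using (↔⇒↣; ↔-sym; ↔-refl)
open import Relation.Binary.Definitions using (DecidableEquality)
open import Relation.Binary.PropositionalEquality
open import Relation.Nullary using (¬_; Dec; yes; no; does; contradiction)
open import Relation.Nullary.Decidable using (dec-true; dec-false; toWitness; T?; from-no)

does-sound : ∀ {P : Set} (P? : Dec P) → T (does P?) → P
does-sound (yes p) _ = p

pigeonhole : ∀ {A : Set} {p q y z w : A} → y ≢ z → y ≢ w → z ≢ w →
             y ≡ p ⊎ y ≡ q → z ≡ p ⊎ z ≡ q → w ≡ p ⊎ w ≡ q → ⊥
pigeonhole y≢z _   _   (inj₁ y≡p) (inj₁ z≡p) _          = y≢z (trans y≡p (sym z≡p))
pigeonhole y≢z _   _   (inj₂ y≡q) (inj₂ z≡q) _          = y≢z (trans y≡q (sym z≡q))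
pigeonhole _   y≢w _   (inj₁ y≡p) (inj₂ _)   (inj₁ w≡p) = y≢w (trans y≡p (sym w≡p))
pigeonhole _   _   z≢w (inj₁ _)   (inj₂ z≡q) (inj₂ w≡q) = z≢w (trans z≡q (sym w≡q))
pigeonhole _   _   z≢w (inj₂ _)   (inj₁ z≡p) (inj₁ w≡p) = z≢w (trans z≡p (sym w≡p))
pigeonhole _   y≢w _   (inj₂ y≡q) (inj₁ _)   (inj₂ w≡q) = y≢w (trans y≡q (sym w≡q))

n≢2+n : ∀ n → n ≢ 2 + n
n≢2+n (suc n) p = n≢2+n n (suc-injective p)

Coloured : {V : Set} {G : Graph V} {d : ℕ} → EdgeLabeling G d → Fin d → V → V → Set
Coloured {G = G} c ℓ x y = adj G x y ≡ true × label c x y ≡ ℓ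

module _ {V : Set} {G : Graph V} {d : ℕ} {c : EdgeLabeling G d} (σ : Automorphism G)
         (σ-preserves : PreservesLabeling σ c) {ℓ : Fin d} where

  open Inverse (perm σ) using (to)

  coloured-preserved : ∀ {x y} → Coloured c ℓ x y → Coloured c ℓ (to x) (to y)
  coloured-preserved {x} {y} (xy , cxy) = trans (preserves σ x y) xy , trans (σ-preserves x y xy) cxy

  coloured-reflected : ∀ {x y} → Coloured c ℓ (to x) (to y) → Coloured c ℓ x y
  coloured-reflected {x} {y} (σxy , cσxy) = xy , trans (sym (σ-preserves x y xy)) cσxy
    where
    xy : adj G x y ≡ true
    xy = trans (sym (preserves σ x y)) σxy

K-adjacent : ∀ {m} {a b : Fin m} → a ≢ b → adj (K m) a b ≡ true
K-adjacent {a = a} {b} a≢b = cong not (dec-false (a ≟ᶠ b) a≢b)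

⋆-adjacentʳ : ∀ {V W} {G : Graph V} {H : Graph W} {x y : V × W} →
              adj H (proj₂ x) (proj₂ y) ≡ true → adj (G ⋆ H) x y ≡ true
⋆-adjacentʳ {G = G} {x = x} {y} p = trans (cong (adj G (proj₁ x) (proj₁ y) ∨_) p) (∨-zeroʳ _)

⋆-congˡ : ∀ {V W} {G G′ : Graph V} {H : Graph W} → (∀ i j → adj G i j ≡ adj G′ i j) →
          ∀ x y → adj (G ⋆ H) x y ≡ adj (G′ ⋆ H) x y
⋆-congˡ {H = H} G≗G′ x y = cong (_∨ adj H (proj₂ x) (proj₂ y)) (G≗G′ (proj₁ x) (proj₁ y))

adjacent⇒≢ : ∀ {V} {G : Graph V} {x y} → adj G x y ≡ true → x ≢ y
adjacent⇒≢ {G = G} {x} xy refl = contradiction (trans (sym xy) (adj-irr G x)) λ ()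

isolated-reach : ∀ {V} {G : Graph V} {u v} → (∀ w → adj G w v ≡ false) → Reach G u v → u ≡ v
isolated-reach isolated here = refl
isolated-reach isolated (step {x = u} uy r) with isolated-reach isolated r
... | refl = contradiction (trans (sym uy) (isolated u)) λ ()

connected-pair : ∀ {G : Graph (Fin 2)} → Connected G → ∀ i j → adj G i j ≡ adj (K 2) i j
connected-pair {G} connected = adjacency
  where
  edge : adj G 0F 1F ≡ true
  edge with adj G 0F 1F in e
  ... | true  = refl
  ... | false = contradiction (isolated-reach isolated (connected 0F 1F)) λ ()
    where
    isolated : ∀ w → adj G w 1F ≡ false
    isolated 0F = e
    isolated 1F = adj-irr G 1F
  adjacency : ∀ i j → adj G i j ≡ adj (K 2) i j
  adjacency 0F 0F = adj-irr G 0F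
  adjacency 0F 1F = edge
  adjacency 1F 0F = trans (adj-sym G 1F 0F) edge
  adjacency 1F 1F = adj-irr G 1F

K-automorphism : ∀ {m} (π : Permutation′ m) (a b : Fin m) → adj (K m) (π ⟨$⟩ʳ a) (π ⟨$⟩ʳ b) ≡ adj (K m) a b
K-automorphism π a b with a ≟ᶠ b
... | yes refl = cong not (dec-true (π ⟨$⟩ʳ a ≟ᶠ π ⟨$⟩ʳ a) refl)
... | no a≢b   = cong not (dec-false (π ⟨$⟩ʳ a ≟ᶠ π ⟨$⟩ʳ b) (a≢b ∘′ Injection.injective (↔⇒↣ π)))

layer-automorphism : ∀ {V} {m} (G : Graph V) → Permutation′ m → Automorphism (G ⋆ K m)
layer-automorphism G π = record
  { perm      = ↔-refl ×-↔ π
  ; preserves = λ x y → cong (adj G (proj₁ x) (proj₁ y) ∨_) (K-automorphism π (proj₂ x) (proj₂ y))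
  }

at-least-two-labels : ∀ {n m d} (G : Graph (Fin (suc n))) →
                      HasDistinguishingLabeling (G ⋆ K (2 + m)) d → 2 ≤ d
at-least-two-labels {d = zero} _ (c , _) with label c (0F , 0F) (0F , 0F)
... | ()
at-least-two-labels {d = 1} G (c , distinguishing)
  with distinguishing (layer-automorphism G (transpose 0F 1F)) (λ _ _ _ → one-label _ _) (0F , 0F)
  where
  one-label : (ℓ ℓ′ : Fin 1) → ℓ ≡ ℓ′
  one-label 0F 0F = refl
... | ()
at-least-two-labels {d = suc (suc d)} _ _ = s≤s (s≤s z≤n)

record Embedding {V : Set} (A : V → V → Set) (f : V → V) : Set where
  field
    injective : ∀ {x y} → f x ≡ f y → x ≡ y
    homomorphic : ∀ {x y} → A x y → A (f x) (f y)

module _ {V : Set} (A : V → V → Set) where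

  Forked : V → Set
  Forked x = ∃₂ λ y z → y ≢ z × A x y × A x z

  Branching : V → Set
  Branching x = ∃₂ λ y z → ∃ λ w → y ≢ z × y ≢ w × z ≢ w × A x y × A x z × A x w

module EmbeddingProperties {V : Set} {A : V → V → Set} {f : V → V} (emb : Embedding A f) where
  open Embedding emb

  ≢-preserved : ∀ {x y} → x ≢ y → f x ≢ f y
  ≢-preserved x≢y fx≡fy = x≢y (injective fx≡fy)

  forked-preserved : ∀ {x} → Forked A x → Forked A (f x)
  forked-preserved (y , z , y≢z , xy , xz) =
    f y , f z , ≢-preserved y≢z , homomorphic xy , homomorphic xz

  branching-preserved : ∀ {x} → Branching A x → Branching A (f x)
  branching-preserved (y , z , w , y≢z , y≢w , z≢w , xy , xz , xw) =
    f y , f z , f w , ≢-preserved y≢z , ≢-preserved y≢w , ≢-preserved z≢w ,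
    homomorphic xy , homomorphic xz , homomorphic xw

  follow : ∀ {u v w u′ v′ w′} → f u ≡ u′ → f v ≡ v′ → A v w → w ≢ u →
           (∀ z → A v′ z → z ≡ u′ ⊎ z ≡ w′) → f w ≡ w′
  follow {w = w} fu fv vw w≢u neighbours with neighbours (f w) (subst (λ a → A a (f w)) fv (homomorphic vw))
  ... | inj₁ fw≡u′ = ⊥-elim (w≢u (injective (trans fw≡u′ (sym fu))))
  ... | inj₂ fw≡w′ = fw≡w′

  walk : (s t : ℕ → V) (N : ℕ) →
         (∀ i → 2 + i ≤ N → A (s (1 + i)) (s (2 + i))) →
         (∀ i → 2 + i ≤ N → s (2 + i) ≢ s i) →
         (∀ i → 2 + i ≤ N → ∀ z → A (t (1 + i)) z → z ≡ t i ⊎ z ≡ t (2 + i)) →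
         f (s 0) ≡ t 0 → f (s 1) ≡ t 1 → ∀ i → i ≤ N → f (s i) ≡ t i
  walk s t N adjacent distinct neighbours f₀ f₁ = along
    where
    pairs : ∀ i → 1 + i ≤ N → f (s i) ≡ t i × f (s (1 + i)) ≡ t (1 + i)
    pairs zero    _ = f₀ , f₁
    pairs (suc i) p with pairs i (≤-trans (n≤1+n _) p)
    ... | fsᵢ , fsᵢ₊₁ = fsᵢ₊₁ , follow fsᵢ fsᵢ₊₁ (adjacent i p) (distinct i p) (neighbours i p)

    along : ∀ i → i ≤ N → f (s i) ≡ t i
    along zero    _ = f₀
    along (suc i) p = proj₂ (pairs i p)

-- The pendant edge 0 — c carries an equation, so that matching on it never unifies c with a pattern.
data Spider (c : ℕ) : ℕ → ℕ → Set where
  leg   : ∀ k → Spider c (suc k) (suc (suc k))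
  leg˘  : ∀ k → Spider c (suc (suc k)) (suc k)
  foot  : ∀ {l} → l ≡ c → Spider c 0 l
  foot˘ : ∀ {k} → k ≡ c → Spider c k 0

module _ {c : ℕ} where

  spider-sym : ∀ {k l} → Spider c k l → Spider c l k
  spider-sym (leg k)   = leg˘ k
  spider-sym (leg˘ k)  = leg k
  spider-sym (foot p)  = foot˘ p
  spider-sym (foot˘ p) = foot p

  spider? : ∀ k l → Dec (Spider c k l)
  spider? zero zero with zero ≟ c
  ... | yes p = yes (foot p)
  ... | no ¬p = no λ { (foot p) → ¬p p ; (foot˘ p) → ¬p p }
  spider? zero (suc l) with suc l ≟ c
  ... | yes p = yes (foot p)
  ... | no ¬p = no λ { (foot p) → ¬p p }
  spider? (suc k) zero with suc k ≟ c
  ... | yes p = yes (foot˘ p)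
  ... | no ¬p = no λ { (foot˘ p) → ¬p p }
  spider? (suc k) (suc l) with l ≟ suc k | k ≟ suc l
  ... | yes refl | _        = yes (leg k)
  ... | no _     | yes refl = yes (leg˘ l)
  ... | no ¬up   | no ¬down = no λ { (leg _) → ¬up refl ; (leg˘ _) → ¬down refl }

  foot-neighbour : ∀ {l} → Spider c 0 l → l ≡ c
  foot-neighbour (foot p)  = p
  foot-neighbour (foot˘ p) = p

  interior-neighbours : ∀ {k l} → suc k ≢ c → Spider c (suc k) l → l ≡ k ⊎ l ≡ suc (suc k)
  interior-neighbours _    (leg _)   = inj₂ refl
  interior-neighbours _    (leg˘ _)  = inj₁ refl
  interior-neighbours k≢c (foot˘ p) = ⊥-elim (k≢c p)

  end-neighbour : ∀ {l} → 1 ≢ c → Spider c 1 l → l ≡ 2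
  end-neighbour _   (leg _)   = refl
  end-neighbour 1≢c (foot˘ p) = ⊥-elim (1≢c p)

Gap : ℕ → ℕ → ℕ → Set
Gap d k l = k + d ≡ l ⊎ l + d ≡ k

spider-gap : ∀ {c k l} → Spider c k l → Gap 1 k l ⊎ Gap c k l
spider-gap (leg k)   = inj₁ (inj₁ (cong suc (+-comm k 1)))
spider-gap (leg˘ k)  = inj₁ (inj₂ (cong suc (+-comm k 1)))
spider-gap (foot p)  = inj₂ (inj₁ (sym p))
spider-gap (foot˘ p) = inj₂ (inj₂ (sym p))

spider-does-sym : ∀ {c} k l → does (spider? {c} k l) ≡ does (spider? {c} l k)
spider-does-sym {c} k l with spider? {c} k l
... | yes s = sym (dec-true (spider? l k) (spider-sym s))
... | no ¬s = sym (dec-false (spider? l k) (¬s ∘′ spider-sym))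

hub-neighbours : ∀ {c l} → Spider c c l → suc l ≡ c ⊎ l ≡ suc c ⊎ l ≡ 0
hub-neighbours (leg _)   = inj₂ (inj₁ refl)
hub-neighbours (leg˘ _)  = inj₁ refl
hub-neighbours (foot p)  = inj₂ (inj₂ p)
hub-neighbours (foot˘ _) = inj₂ (inj₂ refl)

-- The hub c = 3 + b has legs of lengths 1, 2 + b and T − c, all different once c + c ≤ T.
module SpiderRigidity {V : Set} {T : ℕ} (e : V ↔ Fin (suc T)) (b : ℕ) (room : 3 + b + (3 + b) ≤ T) where

  c : ℕ
  c = 3 + b

  idx : V → ℕ
  idx x = toℕ (Inverse.to e x)

  -- positions beyond T are clamped to T
  at : ℕ → V
  at k = Inverse.from e (fromℕ< (s≤s (m⊓n≤n k T)))

  Edge : V → V → Set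
  Edge x y = Spider c (idx x) (idx y)

  idx-injective : ∀ {x y} → idx x ≡ idx y → x ≡ y
  idx-injective p = Injection.injective (↔⇒↣ e) (toℕ-injective p)

  idx-at : ∀ {k} → k ≤ T → idx (at k) ≡ k
  idx-at {k} k≤T = begin
    toℕ (Inverse.to e (at k))          ≡⟨ cong toℕ (Inverse.strictlyInverseˡ e _) ⟩
    toℕ (fromℕ< (s≤s (m⊓n≤n k T)))    ≡⟨ toℕ-fromℕ< _ ⟩
    k ⊓ T                              ≡⟨ m≤n⇒m⊓n≡m k≤T ⟩
    k                                  ∎
    where open ≡-Reasoning

  ≡at : ∀ {x k} → idx x ≡ k → x ≡ at k
  ≡at {x} refl = idx-injective (sym (idx-at (toℕ≤pred[n] (Inverse.to e x))))

  at-≢ : ∀ {k l} → k ≤ T → l ≤ T → k ≢ l → at k ≢ at l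
  at-≢ k≤T l≤T k≢l p = k≢l (trans (sym (idx-at k≤T)) (trans (cong idx p) (idx-at l≤T)))

  edge-at : ∀ {k l} → k ≤ T → l ≤ T → Spider c k l → Edge (at k) (at l)
  edge-at k≤T l≤T = subst₂ (Spider c) (sym (idx-at k≤T)) (sym (idx-at l≤T))

  from-position : ∀ {x z k} → idx x ≡ k → Edge x z → Spider c k (idx z)
  from-position p = subst (λ k → Spider c k _) p

  c≤T : c ≤ T
  c≤T = ≤-trans (m≤m+n c c) room

  c+2≤T : 2 + c ≤ T
  c+2≤T = ≤-trans (+-monoˡ-≤ c {2} {c} (s≤s (s≤s z≤n))) room

  c+1≤T : suc c ≤ T
  c+1≤T = ≤-trans (n≤1+n _) c+2≤T

  below-hub : ∀ {k} → k ≤ c → k ≤ T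
  below-hub k≤c = ≤-trans k≤c c≤T

  foot-neighbours : ∀ {x z} → idx x ≡ 0 → Edge x z → z ≡ at c
  foot-neighbours p xz = ≡at (foot-neighbour (from-position p xz))

  end-neighbours : ∀ {x z} → idx x ≡ 1 → Edge x z → z ≡ at 2
  end-neighbours p xz = ≡at (end-neighbour (λ ()) (from-position p xz))

  path-neighbours : ∀ {x z k} → idx x ≡ suc k → suc k ≢ c → Edge x z → z ≡ at k ⊎ z ≡ at (2 + k)
  path-neighbours p k≢c xz = Sum.map ≡at ≡at (interior-neighbours k≢c (from-position p xz))

  hub-neighbours-at : ∀ {x z} → idx x ≡ c → Edge x z → z ≡ at (2 + b) ⊎ z ≡ at (suc c) ⊎ z ≡ at 0
  hub-neighbours-at p xz with hub-neighbours (from-position p xz)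
  ... | inj₁ q          = inj₁ (≡at (suc-injective q))
  ... | inj₂ (inj₁ q)   = inj₂ (inj₁ (≡at q))
  ... | inj₂ (inj₂ q)   = inj₂ (inj₂ (≡at q))

  forked-at : ∀ {k} → 3 + k ≤ T → Forked Edge (at (2 + k))
  forked-at {k} p =
    at (suc k) , at (3 + k) , at-≢ (≤-trans (n≤1+n _) (≤-trans (n≤1+n _) p)) p (n≢2+n (suc k)) ,
    edge-at (≤-trans (n≤1+n _) p) (≤-trans (n≤1+n _) (≤-trans (n≤1+n _) p)) (leg˘ k) ,
    edge-at (≤-trans (n≤1+n _) p) p (leg (suc k))

  foot-not-forked : ¬ Forked Edge (at 0)
  foot-not-forked (_ , _ , y≢z , xy , xz) =
    y≢z (trans (foot-neighbours (idx-at z≤n) xy) (sym (foot-neighbours (idx-at z≤n) xz)))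

  end-not-forked : ¬ Forked Edge (at 1)
  end-not-forked (_ , _ , y≢z , xy , xz) =
    y≢z (trans (end-neighbours one xy) (sym (end-neighbours one xz)))
    where
    one : idx (at 1) ≡ 1
    one = idx-at (below-hub (s≤s z≤n))

  hub-branching : Branching Edge (at c)
  hub-branching =
    at (2 + b) , at (suc c) , at 0 ,
    at-≢ (below-hub (n≤1+n _)) c+1≤T (n≢2+n (2 + b)) ,
    at-≢ (below-hub (n≤1+n _)) z≤n (λ ()) ,
    at-≢ c+1≤T z≤n (λ ()) ,
    edge-at c≤T (below-hub (n≤1+n _)) (leg˘ (suc b)) ,
    edge-at c≤T c+1≤T (leg (2 + b)) ,
    edge-at c≤T z≤n (foot˘ refl)

  branching⇒hub : ∀ {x} → Branching Edge x → idx x ≡ c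
  branching⇒hub {x} (_ , _ , _ , y≢z , y≢w , z≢w , xy , xz , xw) with idx x ≟ c
  ... | yes p = p
  ... | no ¬p = ⊥-elim (off-hub (idx x) refl)
    where
    off-hub : ∀ k → idx x ≡ k → ⊥
    off-hub zero    p = y≢z (trans (foot-neighbours p xy) (sym (foot-neighbours p xz)))
    off-hub (suc k) p = pigeonhole y≢z y≢w z≢w (neighbours xy) (neighbours xz) (neighbours xw)
      where
      neighbours : ∀ {z} → Edge x z → z ≡ at k ⊎ z ≡ at (2 + k)
      neighbours = path-neighbours p (λ q → ¬p (trans p q))

  ascending-bound : ∀ {N i} → N + c ≤ T → 2 + i ≤ N → 2 + i + c ≤ T
  ascending-bound N+c≤T p = ≤-trans (+-monoˡ-≤ c p) N+c≤T

  ascending-edge : ∀ {N} → N + c ≤ T → ∀ i → 2 + i ≤ N → Edge (at (1 + i + c)) (at (2 + i + c))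
  ascending-edge N+c≤T i p = edge-at (≤-trans (n≤1+n _) fits) fits (leg (i + c))
    where
    fits : 2 + i + c ≤ T
    fits = ascending-bound N+c≤T p

  ascending-distinct : ∀ {N} → N + c ≤ T → ∀ i → 2 + i ≤ N → at (2 + i + c) ≢ at (i + c)
  ascending-distinct N+c≤T i p = at-≢ fits (≤-trans (≤-trans (n≤1+n _) (n≤1+n _)) fits) (≢-sym (n≢2+n (i + c)))
    where
    fits : 2 + i + c ≤ T
    fits = ascending-bound N+c≤T p

  ascending-neighbours : ∀ {N} → N + c ≤ T → ∀ i → 2 + i ≤ N →
                         ∀ z → Edge (at (1 + i + c)) z → z ≡ at (i + c) ⊎ z ≡ at (2 + i + c)
  ascending-neighbours N+c≤T i p z =
    path-neighbours (idx-at (≤-trans (n≤1+n _) (ascending-bound N+c≤T p))) (≢-sym (<⇒≢ (s≤s (m≤n+m c i))))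

  ∸-suc : ∀ {n i} → i ≤ n → suc n ∸ i ≡ suc (n ∸ i)
  ∸-suc = +-∸-assoc 1

  descending-edge : ∀ i → 2 + i ≤ 2 + b → Edge (at (c ∸ (1 + i))) (at (c ∸ (2 + i)))
  descending-edge i (s≤s (s≤s i≤b))
    rewrite ∸-suc {1 + b} (m≤n⇒m≤1+n i≤b) | ∸-suc i≤b =
    edge-at (below-hub (s≤s (s≤s (m≤n⇒m≤1+n (m∸n≤m b i))))) (below-hub (s≤s (m≤n⇒m≤1+n (m≤n⇒m≤1+n (m∸n≤m b i)))))
           (leg˘ (b ∸ i))

  descending-distinct : ∀ i → 2 + i ≤ 2 + b → at (c ∸ (2 + i)) ≢ at (c ∸ i)
  descending-distinct i (s≤s (s≤s i≤b))
    rewrite ∸-suc {2 + b} (m≤n⇒m≤1+n (m≤n⇒m≤1+n i≤b)) | ∸-suc {1 + b} (m≤n⇒m≤1+n i≤b) =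
    at-≢ (below-hub (m≤n⇒m≤1+n (m≤n⇒m≤1+n (m∸n≤m (1 + b) i)))) (below-hub (s≤s (s≤s (m∸n≤m (1 + b) i))))
         (n≢2+n _)

  descending-neighbours : ∀ i → 2 + i ≤ 2 + b →
                          ∀ z → Edge (at (c ∸ (1 + i))) z → z ≡ at (c ∸ i) ⊎ z ≡ at (c ∸ (2 + i))
  descending-neighbours i (s≤s (s≤s i≤b)) z
    rewrite ∸-suc {2 + b} (m≤n⇒m≤1+n (m≤n⇒m≤1+n i≤b)) | ∸-suc {1 + b} (m≤n⇒m≤1+n i≤b) =
    Sum.swap ∘′ path-neighbours (idx-at (below-hub (m≤n⇒m≤1+n (s≤s K≤1+b)))) (<⇒≢ (s≤s (s≤s K≤1+b)))
    where
    K≤1+b : 1 + b ∸ i ≤ 1 + b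
    K≤1+b = m∸n≤m (1 + b) i

  -- σ fixes the hub, the only branching vertex, and the foot, the only leaf next to it. It cannot swap
  -- the two long legs, so it fixes the vertex after the hub and then everything, walking out along the legs.
  module _ (σ : V ↔ V)
           (σ-preserves : ∀ {x y} → Edge x y → Edge (Inverse.to σ x) (Inverse.to σ y))
           (σ-reflects : ∀ {x y} → Edge (Inverse.to σ x) (Inverse.to σ y) → Edge x y) where

    open Inverse σ using (to; from; strictlyInverseˡ; strictlyInverseʳ)

    σ-embedding : Embedding Edge to
    σ-embedding = record { injective = Injection.injective (↔⇒↣ σ) ; homomorphic = σ-preserves }

    σ⁻¹-embedding : Embedding Edge from
    σ⁻¹-embedding = record
      { injective   = λ {x} {y} p → trans (sym (strictlyInverseˡ x)) (trans (cong to p) (strictlyInverseˡ y))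
      ; homomorphic = λ {x} {y} xy → σ-reflects (subst₂ Edge (sym (strictlyInverseˡ x)) (sym (strictlyInverseˡ y)) xy)
      }

    open EmbeddingProperties σ-embedding
    open Embedding σ-embedding using (injective)

    forked-reflected : ∀ {x} → Forked Edge (to x) → Forked Edge x
    forked-reflected {x} =
      subst (Forked Edge) (strictlyInverseʳ x) ∘′ EmbeddingProperties.forked-preserved σ⁻¹-embedding

    fixes-hub : to (at c) ≡ at c
    fixes-hub = ≡at (branching⇒hub (branching-preserved hub-branching))

    hub-image-neighbours : ∀ {x} → Edge (at c) x → to x ≡ at (2 + b) ⊎ to x ≡ at (suc c) ⊎ to x ≡ at 0
    hub-image-neighbours cx = hub-neighbours-at (idx-at c≤T) (subst (λ h → Edge h _) fixes-hub (σ-preserves cx))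

    fixes-foot : to (at 0) ≡ at 0
    fixes-foot with hub-image-neighbours (edge-at c≤T z≤n (foot˘ refl))
    ... | inj₁ p        = ⊥-elim (foot-not-forked (forked-reflected (subst (Forked Edge) (sym p) (forked-at c≤T))))
    ... | inj₂ (inj₁ p) = ⊥-elim (foot-not-forked (forked-reflected (subst (Forked Edge) (sym p) (forked-at c+2≤T))))
    ... | inj₂ (inj₂ p) = p

    hub-successor : to (at (suc c)) ≡ at (suc c) ⊎ to (at (suc c)) ≡ at (2 + b)
    hub-successor with hub-image-neighbours (edge-at c≤T c+1≤T (leg (2 + b)))
    ... | inj₁ p        = inj₂ p
    ... | inj₂ (inj₁ p) = inj₁ p
    ... | inj₂ (inj₂ p) = ⊥-elim (at-≢ c+1≤T z≤n (λ ()) (injective (trans p (sym fixes-foot))))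

    -- Swapping the two long legs would carry the vertex 2c − 1, which has two neighbours, to the end vertex 1.
    legs-not-swapped : to (at (suc c)) ≢ at (2 + b)
    legs-not-swapped p = end-not-forked (subst (Forked Edge) reaches-end (forked-preserved (forked-at room)))
      where
      reaches-end : to (at (2 + b + c)) ≡ at 1
      reaches-end = subst (λ j → to (at (2 + b + c)) ≡ at j) (m+n∸n≡m 1 b)
        (walk (λ i → at (i + c)) (λ i → at (c ∸ i)) (2 + b)
              (ascending-edge (≤-trans (n≤1+n _) room)) (ascending-distinct (≤-trans (n≤1+n _) room))
              descending-neighbours fixes-hub p (2 + b) ≤-refl)

    module _ (fixes-successor : to (at (suc c)) ≡ at (suc c)) where

      fixes-predecessor : to (at (2 + b)) ≡ at (2 + b)
      fixes-predecessor with hub-image-neighbours (edge-at c≤T (below-hub (n≤1+n _)) (leg˘ (suc b)))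
      ... | inj₁ p        = p
      ... | inj₂ (inj₁ p) =
        ⊥-elim (at-≢ (below-hub (n≤1+n _)) c+1≤T (n≢2+n (2 + b)) (injective (trans p (sym fixes-successor))))
      ... | inj₂ (inj₂ p) = ⊥-elim (at-≢ (below-hub (n≤1+n _)) z≤n (λ ()) (injective (trans p (sym fixes-foot))))

      fixes-above-hub : ∀ i → i ≤ T ∸ c → to (at (i + c)) ≡ at (i + c)
      fixes-above-hub = walk (λ i → at (i + c)) (λ i → at (i + c)) (T ∸ c)
        (ascending-edge fits) (ascending-distinct fits) (ascending-neighbours fits) fixes-hub fixes-successor
        where
        fits : T ∸ c + c ≤ T
        fits = ≤-reflexive (m∸n+n≡m c≤T)

      fixes-below-hub : ∀ i → i ≤ 2 + b → to (at (c ∸ i)) ≡ at (c ∸ i)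
      fixes-below-hub = walk (λ i → at (c ∸ i)) (λ i → at (c ∸ i)) (2 + b)
        descending-edge descending-distinct descending-neighbours fixes-hub fixes-predecessor

      fixes-at : ∀ k → k ≤ T → to (at k) ≡ at k
      fixes-at zero    _   = fixes-foot
      fixes-at (suc k) k≤T with c ≤? suc k
      ... | yes c≤k = subst (λ j → to (at j) ≡ at j) (m∸n+n≡m c≤k) (fixes-above-hub (suc k ∸ c) (∸-monoˡ-≤ c k≤T))
      ... | no  c≰k = subst (λ j → to (at j) ≡ at j) (m∸[m∸n]≡n (<⇒≤ (≰⇒> c≰k)))
                        (fixes-below-hub (c ∸ suc k) (∸-monoʳ-≤ {1} {suc k} c (s≤s z≤n)))

    spider-rigid : ∀ x → to x ≡ x
    spider-rigid x with hub-successor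
    ... | inj₂ swapped = ⊥-elim (legs-not-swapped swapped)
    ... | inj₁ fixed   = trans (cong to x≡at) (trans (fixes-at fixed (idx x) (toℕ≤pred[n] _)) (sym x≡at))
      where
      x≡at : x ≡ at (idx x)
      x≡at = ≡at refl

same-layer-gap : ∀ {n m d} (i j : Fin n) (a : Fin m) → toℕ (combine i a) + d ≡ toℕ (combine j a) → m ∣ d
same-layer-gap {m = m} {d} i j a gap = ∣m+n∣m⇒∣n (subst (m ∣_) shifted (m∣m*n (toℕ j))) (m∣m*n (toℕ i))
  where
  open ≡-Reasoning
  shifted : m * toℕ j ≡ m * toℕ i + d
  shifted = +-cancelʳ-≡ (toℕ a) _ _ (begin
    m * toℕ j + toℕ a          ≡⟨ toℕ-combine j a ⟨
    toℕ (combine j a)          ≡⟨ gap ⟨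
    toℕ (combine i a) + d      ≡⟨ cong (_+ d) (toℕ-combine i a) ⟩
    m * toℕ i + toℕ a + d      ≡⟨ +-assoc (m * toℕ i) (toℕ a) d ⟩
    m * toℕ i + (toℕ a + d)    ≡⟨ cong (m * toℕ i +_) (+-comm (toℕ a) d) ⟩
    m * toℕ i + (d + toℕ a)    ≡⟨ +-assoc (m * toℕ i) d (toℕ a) ⟨
    m * toℕ i + d + toℕ a      ∎)

module SpiderLabeling {n m : ℕ} (G : Graph (Fin (suc n))) (b : ℕ) (m∤c : ¬ suc m ∣ 3 + b) where

  c : ℕ
  c = 3 + b

  vertices↔positions : (Fin (suc n) × Fin (suc m)) ↔ Fin (suc n * suc m)
  vertices↔positions = ↔-sym *↔×

  idx : Fin (suc n) × Fin (suc m) → ℕ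
  idx x = toℕ (Inverse.to vertices↔positions x)

  same-layer-divides : ∀ {d} (i j : Fin (suc n)) (a : Fin (suc m)) → Gap d (idx (i , a)) (idx (j , a)) → suc m ∣ d
  same-layer-divides i j a (inj₁ g) = same-layer-gap i j a g
  same-layer-divides i j a (inj₂ g) = same-layer-gap j i a g

  crosses-layers : ∀ {x y} → Spider c (idx x) (idx y) → proj₂ x ≢ proj₂ y
  crosses-layers {i , a} {j , .a} s refl with spider-gap s
  ... | inj₁ gap₁ = m∤c (∣-trans (same-layer-divides i j a gap₁) (1∣ c))
  ... | inj₂ gapc = m∤c (same-layer-divides i j a gapc)

  indicator : Bool → Fin 2
  indicator t = if t then 1F else 0F

  spider-labeling : EdgeLabeling (G ⋆ K (suc m)) 2
  spider-labeling = record
    { label     = λ x y → indicator (does (spider? {c} (idx x) (idx y)))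
    ; label-sym = λ x y → cong indicator (spider-does-sym {c} (idx x) (idx y))
    }

  spider⇒coloured : ∀ {x y} → Spider c (idx x) (idx y) → Coloured spider-labeling 1F x y
  spider⇒coloured {x} {y} s =
    ⋆-adjacentʳ {G = G} {H = K (suc m)} {x = x} {y} (K-adjacent (crosses-layers {x} {y} s)) ,
    cong indicator (dec-true (spider? (idx x) (idx y)) s)

  coloured⇒spider : ∀ {x y} → Coloured spider-labeling 1F x y → Spider c (idx x) (idx y)
  coloured⇒spider {x} {y} (_ , labelled) = decided (spider? (idx x) (idx y)) labelled
    where
    decided : ∀ {P : Set} (P? : Dec P) → indicator (does P?) ≡ 1F → P
    decided (yes p) _ = p

  spider-distinguishing : 3 + b + (3 + b) < suc n * suc m → Distinguishing spider-labeling
  spider-distinguishing (s≤s room) σ σ-preserves = spider-rigid (perm σ) edge-preserved edge-reflected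
    where
    open SpiderRigidity vertices↔positions b room
    open Inverse (perm σ) using (to)

    edge-preserved : ∀ {x y} → Edge x y → Edge (to x) (to y)
    edge-preserved {x} {y} =
      coloured⇒spider ∘′ coloured-preserved {c = spider-labeling} σ σ-preserves ∘′ spider⇒coloured {x} {y}

    edge-reflected : ∀ {x y} → Edge (to x) (to y) → Edge x y
    edge-reflected {x} {y} =
      coloured⇒spider {x} {y} ∘′ coloured-reflected {c = spider-labeling} σ σ-preserves ∘′ spider⇒coloured

spider-labeling-distinguishes : ∀ {n m} (G : Graph (Fin (suc n))) (b : ℕ) → ¬ suc m ∣ 3 + b →
  3 + b + (3 + b) < suc n * suc m → HasDistinguishingLabeling (G ⋆ K (suc m)) 2
spider-labeling-distinguishes G b m∤c fits = spider-labeling , spider-distinguishing fits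
  where open SpiderLabeling G b m∤c

-- A backtracking search: only-identity as vs extends the partial map as over vs in every way consistent
-- with R and checks that each completed map is the identity.
module ExhaustiveRigidity {V : Set} (_≟_ : DecidableEquality V) (vertices : List V)
                          (complete : ∀ x → x ∈ vertices) (R : V → V → ℕ) where

  Assignment : Set
  Assignment = List (V × V)

  consistent : Assignment → V → V → Bool
  consistent as v w = (R v v ≡ᵇ R w w) ∧ all (λ (p , q) → R v p ≡ᵇ R w q) as

  only-identity : Assignment → List V → Bool
  only-identity as []       = all (λ (p , q) → does (p ≟ q)) as
  only-identity as (v ∷ vs) = all (λ w → if consistent as v w then only-identity ((v , w) ∷ as) vs else true) vertices

  module _ (σ : V → V) (σ-preserves : ∀ x y → R (σ x) (σ y) ≡ R x y) where

    Extends : Assignment → Set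
    Extends = All (λ (p , q) → σ p ≡ q)

    σ-consistent : ∀ {as} v → Extends as → T (consistent as v (σ v))
    σ-consistent {as} v extends = Equivalence.from T-∧
      ( ≡⇒≡ᵇ _ _ (sym (σ-preserves v v))
      , all⁻ (λ (p , q) → R v p ≡ᵇ R (σ v) q) (All.map (λ { refl → ≡⇒≡ᵇ _ _ (sym (σ-preserves v _)) }) extends))

    sound : ∀ as vs → T (only-identity as vs) → Extends as →
            All (λ v → σ v ≡ v) vs × All (λ (p , _) → σ p ≡ p) as
    sound as [] identity extends =
      [] , All.zipWith (λ { {p , q} (σp≡q , p≡q) → trans σp≡q (sym (does-sound (p ≟ q) p≡q)) })
                       (extends , all⁺ (λ (p , q) → does (p ≟ q)) as identity)
    sound as (v ∷ vs) search extends with sound ((v , σ v) ∷ as) vs continue (refl ∷ extends)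
      where
      taken : ∀ {a b} → T a → T (if a then b else true) → T b
      taken {true} _ t = t
      continue : T (only-identity ((v , σ v) ∷ as) vs)
      continue = taken (σ-consistent v extends) (All.lookup (all⁺ _ vertices search) (complete (σ v)))
    ... | fixed , σv≡v ∷ fixed′ = σv≡v ∷ fixed , fixed′

    rigid : T (only-identity [] vertices) → ∀ x → σ x ≡ x
    rigid search x = All.lookup (proj₁ (sound [] vertices search [])) (complete x)

edge-code : ∀ {d} → Bool → Fin d → ℕ
edge-code true  ℓ = suc (toℕ ℓ)
edge-code false _ = 0

labelled-adjacency : ∀ {V : Set} {G : Graph V} {d} → EdgeLabeling G d → V → V → ℕ
labelled-adjacency {G = G} c x y = edge-code (adj G x y) (label c x y)

labelled-adjacency-preserved : ∀ {V : Set} {G : Graph V} {d} {c : EdgeLabeling G d} (σ : Automorphism G) →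
  PreservesLabeling σ c → ∀ x y →
  labelled-adjacency c (Inverse.to (perm σ) x) (Inverse.to (perm σ) y) ≡ labelled-adjacency c x y
labelled-adjacency-preserved {G = G} {c = c} σ σ-preserves x y
  with adj G x y in xy | adj G (Inverse.to (perm σ) x) (Inverse.to (perm σ) y) in σxy
... | true  | true  = cong (suc ∘′ toℕ) (σ-preserves x y xy)
... | false | false = refl
... | true  | false = contradiction (trans (sym σxy) (trans (preserves σ x y) xy)) λ ()
... | false | true  = contradiction (trans (sym σxy) (trans (preserves σ x y) xy)) λ ()

grid : ∀ n m → List (Fin n × Fin m)
grid n m = cartesianProduct (allFin n) (allFin m)

∈-grid : ∀ {n m} (x : Fin n × Fin m) → x ∈ grid n m
∈-grid (i , a) = ∈-cartesianProduct⁺ (∈-allFin i) (∈-allFin a)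

module _ {n m : ℕ} where
  open ExhaustiveRigidity (≡-dec _≟ᶠ_ _≟ᶠ_) (grid n m) ∈-grid

  exhaustively-distinguishing : ∀ {d} {P : Graph (Fin n × Fin m)} (c : EdgeLabeling P d) (R : _ → _ → ℕ) →
    (∀ x y → labelled-adjacency c x y ≡ R x y) → T (only-identity R [] (grid n m)) → Distinguishing c
  exhaustively-distinguishing c R c≗R search σ σ-preserves =
    rigid R (Inverse.to (perm σ))
      (λ x y → trans (sym (c≗R _ _)) (trans (labelled-adjacency-preserved {c = c} σ σ-preserves x y) (c≗R x y)))
      search

module Listed {V : Set} (_≟_ : DecidableEquality V) {d : ℕ} where

  joins : V → V → V → V → Bool
  joins p q x y = (does (p ≟ x) ∧ does (q ≟ y)) ∨ (does (p ≟ y) ∧ does (q ≟ x))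

  listed : List (V × V × Fin (suc d)) → V → V → Fin (suc d)
  listed []                   x y = 0F
  listed ((p , q , ℓ) ∷ rest) x y = if joins p q x y then ℓ else listed rest x y

  listed-sym : ∀ L x y → listed L x y ≡ listed L y x
  listed-sym []                   x y = refl
  listed-sym ((p , q , ℓ) ∷ rest) x y =
    cong₂ (if_then ℓ else_) (∨-comm (does (p ≟ x) ∧ does (q ≟ y)) _) (listed-sym rest x y)

  listed-labeling : (G : Graph V) → List (V × V × Fin (suc d)) → EdgeLabeling G (suc d)
  listed-labeling G L = record { label = listed L ; label-sym = listed-sym L }

triangle : Bool → Bool → Bool → Fin 3 → Fin 3 → Bool
triangle a b c 0F 1F = a
triangle a b c 1F 0F = a
triangle a b c 0F 2F = b
triangle a b c 2F 0F = b
triangle a b c 1F 2F = c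
triangle a b c 2F 1F = c
triangle a b c _  _  = false

triangle-adjacency : ∀ (G : Graph (Fin 3)) i j → adj G i j ≡ triangle (adj G 0F 1F) (adj G 0F 2F) (adj G 1F 2F) i j
triangle-adjacency G 0F 0F = adj-irr G 0F
triangle-adjacency G 0F 1F = refl
triangle-adjacency G 0F 2F = refl
triangle-adjacency G 1F 0F = adj-sym G 1F 0F
triangle-adjacency G 1F 1F = adj-irr G 1F
triangle-adjacency G 1F 2F = refl
triangle-adjacency G 2F 0F = adj-sym G 2F 0F
triangle-adjacency G 2F 1F = adj-sym G 2F 1F
triangle-adjacency G 2F 2F = adj-irr G 2F

triangle-adjacency′ : ∀ (G : Graph (Fin 3)) {a b c} → adj G 0F 1F ≡ a → adj G 0F 2F ≡ b → adj G 1F 2F ≡ c →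
                      ∀ i j → adj G i j ≡ triangle a b c i j
triangle-adjacency′ G refl refl refl = triangle-adjacency G

module SmallProducts {n m : ℕ} where
  open ExhaustiveRigidity (≡-dec _≟ᶠ_ _≟ᶠ_) (grid n m) ∈-grid using (only-identity)
  open Listed (≡-dec (_≟ᶠ_ {n}) (_≟ᶠ_ {m})) public

  product-code : ∀ {d} → (Fin n → Fin n → Bool) → List ((Fin n × Fin m) × (Fin n × Fin m) × Fin (suc d)) →
                 Fin n × Fin m → Fin n × Fin m → ℕ
  product-code g L x y = edge-code (g (proj₁ x) (proj₁ y) ∨ adj (K m) (proj₂ x) (proj₂ y)) (listed L x y)

  listed-distinguishing : ∀ {d} (G : Graph (Fin n)) {g : Fin n → Fin n → Bool} → (∀ i j → adj G i j ≡ g i j) →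
    (L : List ((Fin n × Fin m) × (Fin n × Fin m) × Fin (suc d))) →
    T (only-identity (product-code g L) [] (grid n m)) → Distinguishing (listed-labeling (G ⋆ K m) L)
  listed-distinguishing G G≗g L =
    exhaustively-distinguishing (listed-labeling (G ⋆ K m) L) (product-code _ L)
      (λ x y → cong (λ t → edge-code (t ∨ adj (K m) (proj₂ x) (proj₂ y)) (listed L x y)) (G≗g (proj₁ x) (proj₁ y)))

  unit-labelled : List ((Fin n × Fin m) × (Fin n × Fin m)) → List ((Fin n × Fin m) × (Fin n × Fin m) × Fin 2)
  unit-labelled = map λ (x , y) → x , y , 1F

K₂⋆K₃-distinguishing : ∀ (G : Graph (Fin 2)) → Connected G → HasDistinguishingLabeling (G ⋆ K 3) 2
K₂⋆K₃-distinguishing G connected =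
  listed-labeling (G ⋆ K 3) L , listed-distinguishing G (connected-pair connected) L _
  where
  open SmallProducts
  L : List ((Fin 2 × Fin 3) × (Fin 2 × Fin 3) × Fin 2)
  L = unit-labelled
    (((0F , 0F) , (1F , 2F)) ∷ ((0F , 1F) , (1F , 1F)) ∷ ((0F , 2F) , (1F , 0F)) ∷
     ((0F , 2F) , (1F , 2F)) ∷ ((1F , 0F) , (1F , 1F)) ∷ ((1F , 0F) , (1F , 2F)) ∷ [])

K₂⋆K₂-three-labels : ∀ (G : Graph (Fin 2)) → Connected G → HasDistinguishingLabeling (G ⋆ K 2) 3
K₂⋆K₂-three-labels G connected =
  listed-labeling (G ⋆ K 2) L , listed-distinguishing G (connected-pair connected) L _
  where
  open SmallProducts
  L : List ((Fin 2 × Fin 2) × (Fin 2 × Fin 2) × Fin 3)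
  L = ((0F , 1F) , (1F , 1F) , 1F) ∷ ((1F , 0F) , (1F , 1F) , 2F) ∷ []

order-three⋆K₂-distinguishing : ∀ (G : Graph (Fin 3)) → Connected G → HasDistinguishingLabeling (G ⋆ K 2) 2
order-three⋆K₂-distinguishing G connected = listed-labeling (G ⋆ K 2) L , by-shape _ _ _ refl refl refl
  where
  open SmallProducts
  L : List ((Fin 3 × Fin 2) × (Fin 3 × Fin 2) × Fin 2)
  L = unit-labelled
    (((0F , 0F) , (0F , 1F)) ∷ ((0F , 0F) , (1F , 0F)) ∷ ((0F , 0F) , (2F , 0F)) ∷ ((0F , 1F) , (1F , 0F)) ∷
     ((0F , 1F) , (2F , 1F)) ∷ ((1F , 1F) , (2F , 1F)) ∷ ((2F , 0F) , (2F , 1F)) ∷ [])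

  isolated : ∀ {v} u → u ≢ v → ¬ (∀ w → adj G w v ≡ false)
  isolated u u≢v no-edge = u≢v (isolated-reach no-edge (connected u _))

  by-shape : ∀ a b c → adj G 0F 1F ≡ a → adj G 0F 2F ≡ b → adj G 1F 2F ≡ c →
             Distinguishing (listed-labeling (G ⋆ K 2) L)
  by-shape true  true  true  ab ac bc = listed-distinguishing G (triangle-adjacency′ G ab ac bc) L _
  by-shape true  true  false ab ac bc = listed-distinguishing G (triangle-adjacency′ G ab ac bc) L _
  by-shape true  false true  ab ac bc = listed-distinguishing G (triangle-adjacency′ G ab ac bc) L _
  by-shape false true  true  ab ac bc = listed-distinguishing G (triangle-adjacency′ G ab ac bc) L _
  by-shape false false _     ab ac _  = ⊥-elim (isolated 1F (λ ())
    λ { 0F → adj-irr G 0F ; 1F → trans (adj-sym G 1F 0F) ab ; 2F → trans (adj-sym G 2F 0F) ac })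
  by-shape false true  false ab _  bc = ⊥-elim (isolated 0F (λ ())
    λ { 0F → ab ; 1F → adj-irr G 1F ; 2F → trans (adj-sym G 2F 1F) bc })
  by-shape true  false false _  ac bc = ⊥-elim (isolated 0F (λ ())
    λ { 0F → ac ; 1F → bc ; 2F → adj-irr G 2F })

module K₂⋆K₂-TwoLabels where
  open SmallProducts {2} {2}

  Vertex : Set
  Vertex = Fin 2 × Fin 2

  _≟ᵥ_ : DecidableEquality Vertex
  _≟ᵥ_ = ≡-dec _≟ᶠ_ _≟ᶠ_

  v₀ v₁ v₂ v₃ : Vertex
  v₀ = 0F , 0F
  v₁ = 0F , 1F
  v₂ = 1F , 0F
  v₃ = 1F , 1F

  tabulated : (t₀₁ t₀₂ t₀₃ t₁₂ t₁₃ t₂₃ : Fin 2) → Vertex → Vertex → Fin 2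
  tabulated t₀₁ t₀₂ t₀₃ t₁₂ t₁₃ t₂₃ = listed
    ((v₀ , v₁ , t₀₁) ∷ (v₀ , v₂ , t₀₂) ∷ (v₀ , v₃ , t₀₃) ∷ (v₁ , v₂ , t₁₂) ∷ (v₁ , v₃ , t₁₃) ∷ (v₂ , v₃ , t₂₃) ∷ [])

  module _ {G : Graph (Fin 2)} (c : EdgeLabeling (G ⋆ K 2) 2) where

    table : Vertex → Vertex → Fin 2
    table = tabulated (label c v₀ v₁) (label c v₀ v₂) (label c v₀ v₃)
                      (label c v₁ v₂) (label c v₁ v₃) (label c v₂ v₃)

    label-table : ∀ x y → x ≢ y → label c x y ≡ table x y
    label-table (0F , 0F) (0F , 0F) x≢y = ⊥-elim (x≢y refl)
    label-table (0F , 0F) (0F , 1F) _   = refl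
    label-table (0F , 0F) (1F , 0F) _   = refl
    label-table (0F , 0F) (1F , 1F) _   = refl
    label-table (0F , 1F) (0F , 0F) _   = label-sym c _ _
    label-table (0F , 1F) (0F , 1F) x≢y = ⊥-elim (x≢y refl)
    label-table (0F , 1F) (1F , 0F) _   = refl
    label-table (0F , 1F) (1F , 1F) _   = refl
    label-table (1F , 0F) (0F , 0F) _   = label-sym c _ _
    label-table (1F , 0F) (0F , 1F) _   = label-sym c _ _
    label-table (1F , 0F) (1F , 0F) x≢y = ⊥-elim (x≢y refl)
    label-table (1F , 0F) (1F , 1F) _   = refl
    label-table (1F , 1F) (0F , 0F) _   = label-sym c _ _
    label-table (1F , 1F) (0F , 1F) _   = label-sym c _ _
    label-table (1F , 1F) (1F , 0F) _   = label-sym c _ _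
    label-table (1F , 1F) (1F , 1F) x≢y = ⊥-elim (x≢y refl)

  swap : Vertex → Vertex → Vertex → Vertex
  swap u v x = if does (x ≟ᵥ u) then v else if does (x ≟ᵥ v) then u else x

  -- Every graph on four vertices has a nontrivial automorphism, and one of these involutions is one.
  involutions : List (Vertex → Vertex)
  involutions =
    swap v₀ v₁ ∷ swap v₀ v₂ ∷ swap v₀ v₃ ∷ swap v₁ v₂ ∷ swap v₁ v₃ ∷ swap v₂ v₃ ∷
    (swap v₀ v₁ ∘′ swap v₂ v₃) ∷ (swap v₀ v₂ ∘′ swap v₁ v₃) ∷ (swap v₀ v₃ ∘′ swap v₁ v₂) ∷ []

  vertices : List Vertex
  vertices = grid 2 2

  pairs : List (Vertex × Vertex)
  pairs = cartesianProduct vertices vertices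

  ∈-pairs : ∀ x y → (x , y) ∈ pairs
  ∈-pairs x y = ∈-cartesianProduct⁺ (∈-grid x) (∈-grid y)

  returns fixes : (Vertex → Vertex) → Vertex → Bool
  returns π x = does (π (π x) ≟ᵥ x)
  fixes π x = does (π x ≟ᵥ x)

  keeps-adjacency : (Vertex → Vertex) → Vertex × Vertex → Bool
  keeps-adjacency π (x , y) = does (adj (K 2 ⋆ K 2) (π x) (π y) ≟ᵇ adj (K 2 ⋆ K 2) x y)

  keeps-label : (Vertex → Vertex → Fin 2) → (Vertex → Vertex) → Vertex × Vertex → Bool
  keeps-label ℓ π (x , y) = does (ℓ (π x) (π y) ≟ᶠ ℓ x y)

  symmetry-of : (Vertex → Vertex → Fin 2) → (Vertex → Vertex) → Bool
  symmetry-of ℓ π = all (returns π) vertices ∧ not (all (fixes π) vertices) ∧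
                    all (keeps-adjacency π) pairs ∧ all (keeps-label ℓ π) pairs

  every-table-has-symmetry : ∀ t₀₁ t₀₂ t₀₃ t₁₂ t₁₃ t₂₃ →
                             T (any (symmetry-of (tabulated t₀₁ t₀₂ t₀₃ t₁₂ t₁₃ t₂₃)) involutions)
  every-table-has-symmetry = toWitness
    {a? = all? λ t₀₁ → all? λ t₀₂ → all? λ t₀₃ → all? λ t₁₂ → all? λ t₁₃ → all? λ t₂₃ →
          T? (any (symmetry-of (tabulated t₀₁ t₀₂ t₀₃ t₁₂ t₁₃ t₂₃)) involutions)} _

  record Symmetry (ℓ : Vertex → Vertex → Fin 2) (π : Vertex → Vertex) : Set where
    field
      π-involutive : ∀ x → π (π x) ≡ x
      π-moves      : ¬ (∀ x → π x ≡ x)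
      π-adjacency  : ∀ x y → adj (K 2 ⋆ K 2) (π x) (π y) ≡ adj (K 2 ⋆ K 2) x y
      π-labels     : ∀ x y → ℓ (π x) (π y) ≡ ℓ x y

  symmetry-sound : ∀ ℓ π → T (symmetry-of ℓ π) → Symmetry ℓ π
  symmetry-sound ℓ π t
    with Equivalence.to (T-∧ {all (returns π) vertices}) t
  ... | involutive-π , t₁ with Equivalence.to (T-∧ {not (all (fixes π) vertices)}) t₁
  ... | moving-π , t₂ with Equivalence.to (T-∧ {all (keeps-adjacency π) pairs}) t₂
  ... | adjacency-π , labels-π = record
    { π-involutive = λ x → does-sound (π (π x) ≟ᵥ x) (everywhere (returns π) involutive-π x)
    ; π-moves      = λ fixed → not-T moving-π
        (all⁻ (fixes π) {xs = vertices} (All.tabulate λ {x} _ → Equivalence.from T-≡ (dec-true (π x ≟ᵥ x) (fixed x))))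
    ; π-adjacency  = λ x y → does-sound (_ ≟ᵇ _) (everywhere₂ (keeps-adjacency π) adjacency-π x y)
    ; π-labels     = λ x y → does-sound (_ ≟ᶠ _) (everywhere₂ (keeps-label ℓ π) labels-π x y)
    }
    where
    everywhere : ∀ (p : Vertex → Bool) → T (all p vertices) → ∀ x → T (p x)
    everywhere p t x = All.lookup (all⁺ p vertices t) (∈-grid x)

    everywhere₂ : ∀ (p : Vertex × Vertex → Bool) → T (all p pairs) → ∀ x y → T (p (x , y))
    everywhere₂ p t x y = All.lookup (all⁺ p pairs t) (∈-pairs x y)

    not-T : ∀ {b} → T (not b) → ¬ T b
    not-T {false} _ ()

  no-distinguishing-two-labeling : ∀ (G : Graph (Fin 2)) → Connected G →
                                   (c : EdgeLabeling (G ⋆ K 2) 2) → ¬ Distinguishing c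
  no-distinguishing-two-labeling G connected c distinguishing
    with satisfied (any⁻ _ involutions (every-table-has-symmetry
           (label c v₀ v₁) (label c v₀ v₂) (label c v₀ v₃) (label c v₁ v₂) (label c v₁ v₃) (label c v₂ v₃)))
  ... | π , is-symmetry = π-moves (distinguishing σ σ-preserves)
    where
    open Symmetry (symmetry-sound (table c) π is-symmetry)

    as-K₄ : ∀ x y → adj (G ⋆ K 2) x y ≡ adj (K 2 ⋆ K 2) x y
    as-K₄ = ⋆-congˡ {G = G} {K 2} {K 2} (connected-pair connected)

    σ : Automorphism (G ⋆ K 2)
    σ = record
      { perm      = mk↔ₛ′ π π π-involutive π-involutive
      ; preserves = λ x y → trans (as-K₄ (π x) (π y)) (trans (π-adjacency x y) (sym (as-K₄ x y)))
      }

    σ-preserves : PreservesLabeling σ c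
    σ-preserves x y xy = begin
      label c (π x) (π y) ≡⟨ label-table c (π x) (π y) (x≢y ∘′ π-injective) ⟩
      table c (π x) (π y) ≡⟨ π-labels x y ⟩
      table c x y         ≡⟨ label-table c x y x≢y ⟨
      label c x y         ∎
      where
      open ≡-Reasoning
      x≢y : x ≢ y
      x≢y = adjacent⇒≢ {G = G ⋆ K 2} xy
      π-injective : π x ≡ π y → x ≡ y
      π-injective p = trans (sym (π-involutive x)) (trans (cong π p) (π-involutive y))

two-labels : ∀ {n m} (G : Graph (Fin (2 + n))) → Connected G → ¬ (2 + n ≡ 2 × 2 + m ≡ 2) →
             HasDistinguishingLabeling (G ⋆ K (2 + m)) 2
two-labels {0}           {0}           _ _         not-K₂⋆K₂ = ⊥-elim (not-K₂⋆K₂ (refl , refl))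
two-labels {0}           {1}           G connected _ = K₂⋆K₃-distinguishing G connected
two-labels {1}           {0}           G connected _ = order-three⋆K₂-distinguishing G connected
two-labels {1}           {1}           G _         _ = spider-labeling-distinguishes G 1 (from-no (3 ∣? 4)) ≤-refl
two-labels {suc (suc n)} {1}           G _         _ =
  spider-labeling-distinguishes G 1 (from-no (3 ∣? 4)) (≤-trans (m≤m+n 9 3) (*-monoˡ-≤ 3 (m≤m+n 4 n)))
two-labels {n}           {suc (suc m)} G _         _ =
  spider-labeling-distinguishes G 0 (>⇒∤ (s≤s (s≤s (s≤s (s≤s z≤n)))))
    (≤-trans (n≤1+n 7) (*-mono-≤ (m≤m+n 2 n) (m≤m+n 4 m)))
two-labels {suc (suc n)} {0}           G _         _ =
  spider-labeling-distinguishes G 0 (from-no (2 ∣? 3)) (≤-trans (n≤1+n 7) (*-monoˡ-≤ 2 (m≤m+n 4 n)))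

K₂⋆K₂-index : ∀ (G : Graph (Fin 2)) → Connected G → DistIndex (G ⋆ K 2) 3
K₂⋆K₂-index G connected = K₂⋆K₂-three-labels G connected , at-least-three
  where
  at-least-three : ∀ d → HasDistinguishingLabeling (G ⋆ K 2) d → 3 ≤ d
  at-least-three 0 h = contradiction (at-least-two-labels G h) λ ()
  at-least-three 1 h = contradiction (at-least-two-labels G h) λ { (s≤s ()) }
  at-least-three 2 (c , distinguishing) =
    ⊥-elim (K₂⋆K₂-TwoLabels.no-distinguishing-two-labeling G connected c distinguishing)
  at-least-three (suc (suc (suc _))) _ = s≤s (s≤s (s≤s z≤n))

mainTheorem7 : (n : ℕ) (G : Graph (Fin n)) → 2 ≤ n → Connected G →
    (m : ℕ) → 2 ≤ m →
    ((n ≡ 2 × m ≡ 2) → DistIndex (G ⋆ K m) 3) ×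
    (¬ (n ≡ 2 × m ≡ 2) → DistIndex (G ⋆ K m) 2)
mainTheorem7 (suc (suc _)) G (s≤s (s≤s _)) connected (suc (suc _)) (s≤s (s≤s _)) =
  (λ { (refl , refl) → K₂⋆K₂-index G connected }) ,
  (λ not-K₂⋆K₂ → two-labels G connected not-K₂⋆K₂ , λ _ → at-least-two-labels G)
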